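{- In the setting described in the context, the map $\psi:\mathcal D(\pi)\to\mathcal D(\hat\pi)$ is injective.
   Context: A planar network of order $n$ is a directed, planar, acyclic multigraph embedded in the plane with $n$ sources on the left and $n$ sinks on the right, labeled $1,\dots,n$ bottom to top; edges may carry positive integer multiplicities. For an interval $[a,b]\subseteq[n]$, the simple star network $F_{[a,b]}$ has one interior vertex $x$, edges source $i\to x\to$ sink $i$ for $i\in[a,b]$ and source $i\to$ sink $i$ otherwise. A star network $F=F_{[a_1,b_1]}\cdots F_{[a_m,b_m]}$ is built from these by any combination of concatenation (identify sink $i$ of the left piece with source $i$ of the right piece, merging edges) and condensed concatenation (additionally merge $p>1$ parallel edges between two interior vertices into one edge of multiplicity $p$); its interior vertices are $x_1,\dots,x_m$. A covering path family $\pi=(\pi_1,\dots,\pi_n)\in\Pi(F)$ consists of source-to-sink paths, $\pi_i$ from source $i$, with each edge of multiplicity $p$ on exactly $p$ paths. Components of the intersection of two paths are vertices or paths $(x_k,\dots,x_\ell)$; the paths meet at the initial vertex $x_k$ of each component, which is a crossing if they enter $x_k$ and exit $x_\ell$ in different vertical orders. A defect at $x_k$ is a triple $(\pi_i,\pi_j,k)$, $i<j$, with $\pi_i,\pi_j$ meeting at $x_k$ after having crossed an odd number of times. For paths through $x_k$: $\pi_a\prec\pi_b$ if $\pi_a$ enters $x_k$ on an edge below that of $\pi_b$; $\pi_a\sim\pi_b$ if they enter on the same edge; $\pi_a\precsim\pi_b$ if either. Setting: fix $k\in\{2,\dots,m\}$ and $\pi\in\Pi(F)$ with a defect at $x_k$.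 Let $(r,t)$ be the lexicographically least pair with $(\pi_r,\pi_t,k)$ a defect; let $s$ be the largest index with $\pi_s\sim\pi_r$ at $x_k$ and $(\pi_s,\pi_t,k)$ a defect; let $x_\ell$ be the final vertex of the rightmost crossing of $\pi_s,\pi_t$ prior to $x_k$; define $\hat\pi$ by $\hat\pi_i=\pi_i$ ($i\notin\{s,t\}$), and $\hat\pi_s$ ($\hat\pi_t$) equal to $\pi_s$ ($\pi_t$) with its $x_\ell$-to-$x_k$ subpath replaced by that of $\pi_t$ ($\pi_s$). Let $\mathcal D(\pi)$ be the set of defects $(\pi_i,\pi_j,k)$ of $\pi$ at $x_k$ with $|\{i,j\}\cap\{s,t\}|=1$, and $\mathcal D(\hat\pi)$ the analogous set for $\hat\pi$. Relations are at $x_k$. $\mathcal A=\{(\pi_i,\pi_j,k)\in\mathcal D(\pi):\pi_j\prec\pi_t\}$, $\mathcal B=\{\cdots:\pi_s\prec\pi_i\}$, $\mathcal C_1=\{\cdots:\pi_t\precsim\pi_j\prec\pi_i,\ i=s,\ j\ne t\}$, $\mathcal C_2=\{\cdots:j=t,\ \pi_t\prec\pi_i\precsim\pi_s,\ i\ne s\}$; these partition $\mathcal D(\pi)$. The map $\psi:\mathcal D(\pi)\to\mathcal D(\hat\pi)$ sends $(\pi_i,\pi_j,k)\mapsto(\hat\pi_i,\hat\pi_j,k)$ if it lies in $\mathcal A\cup\mathcal B$; $(\pi_s,\pi_j,k)\in\mathcal C_1\mapsto(\hat\pi_t,\hat\pi_j,k)$; $(\pi_i,\pi_t,k)\in\mathcal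 C_2\mapsto(\hat\pi_i,\hat\pi_s,k)$ (its image indeed lies in $\mathcal D(\hat\pi)$). -}

module Defs where

-- Conventions:
--   * sources/sinks/wires are Fin n, index i stands for label i+1
--     (bottom to top);  interior vertices x_1..x_m are Fin m
--     (index c stands for x_{c+1}), ordered left to right.
--   * A star network is built by a syntax tree of concatenations
--     and condensed concatenations of simple star networks.
--   * A path is recorded by the wire it runs along in each of the
--     m+1 "gaps" (gap 0 is left of x_1, gap c is between x_c and
--     x_{c+1}, gap m is right of x_m).

open import Data.Nat.Base using (ℕ; zero; suc; _+_; _≤ᵇ_; _<ᵇ_; _≡ᵇ_)
open import Data.Fin.Base using (Fin; zero; suc; toℕ; inject₁; splitAt)
open import Data.Bool.Base using (Bool; true; false; _∧_; _∨_; not; if_then_else_; T)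
open import Data.Maybe.Base using (Maybe; just; nothing)
open import Data.List.Base using (List; allFin; filterᵇ; head; last; length)
open import Data.Bool.ListAction using (any; all)
open import Data.Sum.Base using (inj₁; inj₂)
open import Data.Product.Base using (_×_; _,_; Σ; ∃)
open import Relation.Binary.PropositionalEquality using (_≡_)
open import Relation.Nullary using (¬_)

private
  variable
    n m n' : ℕ

_≤F_ : Fin n → Fin n' → Bool
a ≤F b = toℕ a ≤ᵇ toℕ b

_<F_ : Fin n → Fin n' → Bool
a <F b = toℕ a <ᵇ toℕ b

_≡F_ : Fin n → Fin n' → Bool
a ≡F b = toℕ a ≡ᵇ toℕ b

count : (Fin n → Bool) → ℕ
count {n} p = length (filterᵇ p (allFin n))

isOdd : ℕ → Bool
isOdd zero    = false
isOdd (suc k) = not (isOdd k)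

record Interval (n : ℕ) : Set where
  constructor interval
  field
    lo hi : Fin n
    lo≤hi : T (lo ≤F hi)

-- star networks with m interior vertices, as built from simple star
-- networks F_[a,b] by concatenation (_·_) and condensed
-- concatenation (_⊙_)
data StarNet (n : ℕ) : ℕ → Set where
  star : Interval n → StarNet n 1
  _·_  : ∀ {m₁ m₂} → StarNet n m₁ → StarNet n m₂ → StarNet n (m₁ + m₂)
  _⊙_  : ∀ {m₁ m₂} → StarNet n m₁ → StarNet n m₂ → StarNet n (m₁ + m₂)

intervalOf : StarNet n m → Fin m → Interval n
intervalOf (star I) _ = I
intervalOf (_·_ {m₁} F₁ F₂) c with splitAt m₁ c
... | inj₁ c₁ = intervalOf F₁ c₁
... | inj₂ c₂ = intervalOf F₂ c₂
intervalOf (_⊙_ {m₁} F₁ F₂) c with splitAt m₁ c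
... | inj₁ c₁ = intervalOf F₁ c₁
... | inj₂ c₂ = intervalOf F₂ c₂

-- whether the parallel edges between interior vertices x_c and x_d
-- (created when the piece containing x_c is joined to the piece
-- containing x_d) were merged, i.e. whether that join is condensed.
joinMerged : ∀ {m₁ m₂} → Bool → (Fin m₁ → Fin m₁ → Bool) → (Fin m₂ → Fin m₂ → Bool) →
             Fin (m₁ + m₂) → Fin (m₁ + m₂) → Bool
joinMerged {m₁ = m₁} b f g c d with splitAt m₁ c | splitAt m₁ d
... | inj₁ c₁ | inj₁ d₁ = f c₁ d₁
... | inj₂ c₂ | inj₂ d₂ = g c₂ d₂
... | inj₁ _  | inj₂ _  = b
... | inj₂ _  | inj₁ _  = b

merged : StarNet n m → Fin m → Fin m → Bool
merged (star _) _ _ = false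
merged (F₁ · F₂) = joinMerged false (merged F₁) (merged F₂)
merged (F₁ ⊙ F₂) = joinMerged true (merged F₁) (merged F₂)

touches : StarNet n m → Fin m → Fin n → Bool
touches F c w = (Interval.lo I ≤F w) ∧ (w ≤F Interval.hi I)
  where I = intervalOf F c

-- Gaps are Fin (suc m).  The interior vertex x_c lies between gap
-- (inject₁ c) and gap (suc c).

-- last interior vertex on wire w left of gap g (nothing = the source)
prevTouch : StarNet n m → Fin n → Fin (suc m) → Maybe (Fin m)
prevTouch {m = m} F w g = last (filterᵇ (λ c → (c <F g) ∧ touches F c w) (allFin m))

-- first interior vertex on wire w right of gap g (nothing = the sink)
nextTouch : StarNet n m → Fin n → Fin (suc m) → Maybe (Fin m)
nextTouch {m = m} F w g = head (filterᵇ (λ c → (g ≤F c) ∧ touches F c w) (allFin m))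

-- the wire segments of wires w and w' through gap g belong to the same
-- edge of F (same segment, or parallel segments between two interior
-- vertices that were merged by a condensed concatenation)
sameEdge : StarNet n m → Fin n → Fin n → Fin (suc m) → Bool
sameEdge F w w' g with prevTouch F w g | nextTouch F w g | prevTouch F w' g | nextTouch F w' g
... | just l | just c | just l' | just c' = (w ≡F w') ∨ ((l ≡F l') ∧ (c ≡F c') ∧ merged F l c)
... | _      | _      | _       | _       = w ≡F w'

-- the edge through gap g containing wire w lies below the edge through
-- gap g containing wire w' (an edge's height is that of its lowest wire)
belowAt : StarNet n m → Fin (suc m) → Fin n → Fin n → Bool
belowAt {n = n} F g w w' =
  any (λ u → sameEdge F u w g ∧ all (λ u' → not (sameEdge F u' w' g) ∨ (u <F u')) (allFin n)) (allFin n)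

WirePath : ℕ → ℕ → Set
WirePath n m = Fin (suc m) → Fin n

IsPath : StarNet n m → WirePath n m → Set
IsPath {m = m} F p = (c : Fin m) →
  (T (touches F c (p (inject₁ c))) → T (touches F c (p (suc c)))) ×
  (¬ T (touches F c (p (inject₁ c))) → p (suc c) ≡ p (inject₁ c))

-- π ∈ Π(F): π_i starts at source i, and every edge of multiplicity p
-- lies on exactly p of the paths
InΠ : StarNet n m → (Fin n → WirePath n m) → Set
InΠ {n = n} {m = m} F π =
  ((i : Fin n) → IsPath F (π i)) ×
  ((i : Fin n) → π i zero ≡ i) ×
  ((w : Fin n) (g : Fin (suc m)) →
     count (λ i → sameEdge F (π i g) w g) ≡ count (λ w' → sameEdge F w' w g))

visits : StarNet n m → WirePath n m → Fin m → Bool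
visits F p c = touches F c (p (inject₁ c))

precAt : StarNet n m → Fin m → WirePath n m → WirePath n m → Bool
precAt F c p q = belowAt F (inject₁ c) (p (inject₁ c)) (q (inject₁ c))

simAt : StarNet n m → Fin m → WirePath n m → WirePath n m → Bool
simAt F c p q = sameEdge F (p (inject₁ c)) (q (inject₁ c)) (inject₁ c)

precsimAt : StarNet n m → Fin m → WirePath n m → WirePath n m → Bool
precsimAt F c p q = precAt F c p q ∨ simAt F c p q

outBelow : StarNet n m → Fin m → WirePath n m → WirePath n m → Bool
outBelow F c p q = belowAt F (suc c) (p (suc c)) (q (suc c))

sameOut : StarNet n m → Fin m → WirePath n m → WirePath n m → Bool
sameOut F c p q = sameEdge F (p (suc c)) (q (suc c)) (suc c)

-- p and q meet at x_c : x_c is the initial vertex of a component of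
-- their intersection (both pass x_c, entering on different edges)
meets : StarNet n m → WirePath n m → WirePath n m → Fin m → Bool
meets F p q c = visits F p c ∧ visits F q c ∧ not (simAt F c p q)

-- the component of p ∩ q with initial vertex x_c has final vertex x_ℓ
compEnd : StarNet n m → WirePath n m → WirePath n m → Fin m → Fin m → Bool
compEnd {m = m} F p q c ℓ =
  meets F p q c ∧ (c ≤F ℓ) ∧ visits F p ℓ ∧ visits F q ℓ ∧ not (sameOut F ℓ p q) ∧
  all (λ d → not ((c <F d) ∧ (d ≤F ℓ) ∧ meets F p q d)) (allFin m)

crossing : StarNet n m → WirePath n m → WirePath n m → Fin m → Fin m → Bool
crossing F p q c ℓ =
  compEnd F p q c ℓ ∧
  ((precAt F c p q ∧ outBelow F ℓ q p) ∨ (precAt F c q p ∧ outBelow F ℓ p q))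

crossingsBefore : StarNet n m → WirePath n m → WirePath n m → Fin m → ℕ
crossingsBefore {m = m} F p q k =
  count (λ c → (c <F k) ∧ any (crossing F p q c) (allFin m))

defect : StarNet n m → (Fin n → WirePath n m) → Fin n → Fin n → Fin m → Bool
defect F π i j k =
  (i <F j) ∧ meets F (π i) (π j) k ∧ isOdd (crossingsBefore F (π i) (π j) k)

LexLeastDefect : StarNet n m → (Fin n → WirePath n m) → Fin m → Fin n → Fin n → Set
LexLeastDefect {n = n} F π k r t =
  T (defect F π r t k) ×
  ((r' t' : Fin n) → T (defect F π r' t' k) → T ((r <F r') ∨ ((r ≡F r') ∧ (t ≤F t'))))

IsS : StarNet n m → (Fin n → WirePath n m) → Fin m → Fin n → Fin n → Fin n → Set
IsS {n = n} F π k r t s =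
  T (simAt F k (π s) (π r)) × T (defect F π s t k) ×
  ((s' : Fin n) → T (simAt F k (π s') (π r)) → T (defect F π s' t k) → T (s' ≤F s))

RightmostCrossing : StarNet n m → WirePath n m → WirePath n m → Fin m → Fin m → Fin m → Set
RightmostCrossing {m = m} F p q k c₀ ℓ =
  T (crossing F p q c₀ ℓ) × T (c₀ <F k) ×
  ((c ℓ' : Fin m) → T (crossing F p q c ℓ') → T (c <F k) → T (c ≤F c₀))

splice : WirePath n m → WirePath n m → Fin m → Fin m → WirePath n m
splice p q ℓ k g = if (ℓ <F g) ∧ (g ≤F k) then q g else p g

hatπ : (Fin n → WirePath n m) → Fin n → Fin n → Fin m → Fin m → Fin n → WirePath n m
hatπ π s t ℓ k i =
  if i ≡F s then splice (π s) (π t) ℓ k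
  else if i ≡F t then splice (π t) (π s) ℓ k
  else π i

-- |{i,j} ∩ {s,t}| = 1  (for i ≠ j)
exactlyOneIn : Fin n → Fin n → Fin n → Fin n → Bool
exactlyOneIn s t i j = (iIn ∧ not jIn) ∨ (not iIn ∧ jIn)
  where
    iIn = (i ≡F s) ∨ (i ≡F t)
    jIn = (j ≡F s) ∨ (j ≡F t)

inD : StarNet n m → (Fin n → WirePath n m) → Fin n → Fin n → Fin m → Fin n → Fin n → Bool
inD F π s t k i j = defect F π i j k ∧ exactlyOneIn s t i j

-- (π̂_i, π̂_j, k) ∈ 𝒟(π̂)   (codomain of ψ; not needed for injectivity)
inDhat : StarNet n m → (Fin n → WirePath n m) → Fin n → Fin n → Fin m → Fin m →
         Fin n → Fin n → Bool
inDhat F π s t ℓ k i j = inD F (hatπ π s t ℓ k) s t k i j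

inA inB inC1 inC2 : StarNet n m → (Fin n → WirePath n m) → Fin n → Fin n → Fin m →
                    Fin n → Fin n → Bool
inA F π s t k i j = inD F π s t k i j ∧ precAt F k (π j) (π t)
inB F π s t k i j = inD F π s t k i j ∧ precAt F k (π s) (π i)
inC1 F π s t k i j =
  inD F π s t k i j ∧ precsimAt F k (π t) (π j) ∧ precAt F k (π j) (π i) ∧
  (i ≡F s) ∧ not (j ≡F t)
inC2 F π s t k i j =
  inD F π s t k i j ∧ (j ≡F t) ∧ precAt F k (π t) (π i) ∧ precsimAt F k (π i) (π s) ∧
  not (i ≡F s)

-- ψ, on index pairs: (π_i,π_j,k) ↦ (π̂_a,π̂_b,k) is recorded as (i,j) ↦ (a,b)
ψ : StarNet n m → (Fin n → WirePath n m) → Fin n → Fin n → Fin m →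
    Fin n → Fin n → Fin n × Fin n
ψ F π s t k i j =
  if inA F π s t k i j ∨ inB F π s t k i j then (i , j)
  else if inC1 F π s t k i j then (t , j)
  else if inC2 F π s t k i j then (i , s)
  else (i , j)

-- Two paths from sources a < b start with π_a below π_b, and their vertical order changes exactly
-- at crossings; so at a defect (π_a, π_b, k), reached after an odd number of crossings, π_b ≺ π_a.
-- The map ψ fixes 𝒜 ∪ ℬ and only renames π_s to π_t on 𝒞₁ and π_t to π_s on 𝒞₂.  An element of 𝒞₁
-- and one of 𝒜 ∪ ℬ with the same image would make (π_t, π_j, k) a defect with π_t ≾ π_j, and
-- similarly (π_i, π_s, k) for 𝒞₂; an element of 𝒞₁ and one of 𝒞₂ would make (π_s, π_s, k) a
-- defect.  Within each class ψ is visibly injective.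

{-# OPTIONS --safe #-}
module Submission where

open import Defs
open import Function.Base using (_∘_; id)
open import Function.Bundles using (_⇔_; mk⇔; Equivalence)
open import Data.Nat.Base using (ℕ; zero; suc; _≤_; _<_; _<ᵇ_; _≤ᵇ_; z≤n; s≤s; s≤s⁻¹)
open import Data.Nat.Properties as ℕ using (≡ᵇ⇒≡; ≡⇒≡ᵇ; <ᵇ⇒<; <⇒<ᵇ; ≤ᵇ⇒≤; ≤⇒≤ᵇ)
open import Data.Fin.Base as Fin using (Fin; zero; suc; toℕ; inject₁)
open import Data.Fin.Properties using (toℕ-injective; toℕ-inject₁; suc-injective; ≤̄⇒inject₁<)
open import Data.Fin.Induction using (<-wellFounded; <-weakInduction)
open import Data.Bool.Base using (Bool; true; false; T; _∧_; _∨_; not; _xor_; if_then_else_)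
open import Data.Bool.Properties using (T?)
open import Data.Bool.ListAction using (any; all)
open import Data.List.Base using (List; []; _∷_; filterᵇ; head; last; length; tabulate; allFin; map)
open import Data.List.Properties using (filter-≐; map-tabulate)
open import Data.List.Relation.Unary.Any.Properties as Any using (any⁺; any⁻)
open import Data.List.Relation.Unary.All.Properties as All using (all⁺; all⁻)
open import Data.Maybe.Base using (Maybe; just; nothing; _<∣>_)
open import Data.Product.Base using (_,_; _×_; proj₁; proj₂; ∃)
open import Data.Sum.Base as Sum using (_⊎_; inj₁; inj₂)
open import Data.Empty using (⊥-elim)
open import Induction.WellFounded using (Acc; acc)
open import Relation.Nullary using (¬_; yes; no)
open import Relation.Binary.Definitions using (tri<; tri≈; tri>)
open import Relation.Binary.PropositionalEquality

private
  variable
    n n′ m : ℕ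
    A X : Set

-- Booleans and finite indices

∧-elimˡ : ∀ {a b} → T (a ∧ b) → T a
∧-elimˡ {true} _ = _

∧-elimʳ : ∀ {a b} → T (a ∧ b) → T b
∧-elimʳ {true} h = h

∧-intro : ∀ {a b} → T a → T b → T (a ∧ b)
∧-intro {true} _ h = h

∨-elim : ∀ {a b} → T (a ∨ b) → T a ⊎ T b
∨-elim {true} h = inj₁ h
∨-elim {false} h = inj₂ h

∨-introˡ : ∀ {a b} → T a → T (a ∨ b)
∨-introˡ {true} _ = _

∨-introʳ : ∀ {a b} → T b → T (a ∨ b)
∨-introʳ {true} _ = _
∨-introʳ {false} h = h

not-intro : ∀ {a} → ¬ T a → T (not a)
not-intro {true} h = h _
not-intro {false} _ = _

not-elim : ∀ {a} → T (not a) → ¬ T a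
not-elim {false} _ ()

¬T⇒≡false : ∀ {a} → ¬ T a → a ≡ false
¬T⇒≡false {true} h = ⊥-elim (h _)
¬T⇒≡false {false} _ = refl

T⇒≡true : ∀ {a} → T a → a ≡ true
T⇒≡true {true} _ = refl

T-ext : ∀ {a b} → (T a → T b) → (T b → T a) → a ≡ b
T-ext {true} {true} _ _ = refl
T-ext {true} {false} f _ = ⊥-elim (f _)
T-ext {false} {true} _ g = ⊥-elim (g _)
T-ext {false} {false} _ _ = refl

∧-congʳ : ∀ {a a′ b} → (T b → a ≡ a′) → (a ∧ b) ≡ (a′ ∧ b)
∧-congʳ {true} {true} _ = refl
∧-congʳ {false} {false} _ = refl
∧-congʳ {true} {false} {true} a≡a′ = a≡a′ _
∧-congʳ {true} {false} {false} _ = refl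
∧-congʳ {false} {true} {true} a≡a′ = a≡a′ _
∧-congʳ {false} {true} {false} _ = refl

xor-self : ∀ b → b xor b ≡ false
xor-self true = refl
xor-self false = refl

exactly-one≡xor : ∀ a b → ((a ∧ not b) ∨ (not a ∧ b)) ≡ a xor b
exactly-one≡xor true true = refl
exactly-one≡xor true false = refl
exactly-one≡xor false b = refl

parity-flip : ∀ o b → b ≡ not ((not o xor b) xor o)
parity-flip true true = refl
parity-flip true false = refl
parity-flip false true = refl
parity-flip false false = refl

≡not : ∀ {a b} → ¬ (T a × T b) → T a ⊎ T b → b ≡ not a
≡not {true} {true} ¬both _ = ⊥-elim (¬both (_ , _))
≡not {true} {false} _ _ = refl
≡not {false} {true} _ _ = refl
≡not {false} {false} _ (inj₁ ())
≡not {false} {false} _ (inj₂ ())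

≡F⇒≡ : {i j : Fin n} → T (i ≡F j) → i ≡ j
≡F⇒≡ {i = i} {j} h = toℕ-injective (≡ᵇ⇒≡ (toℕ i) (toℕ j) h)

≡F-refl : (i : Fin n) → T (i ≡F i)
≡F-refl i = ≡⇒≡ᵇ (toℕ i) (toℕ i) refl

<F⇒< : {i : Fin n} {j : Fin n′} → T (i <F j) → toℕ i < toℕ j
<F⇒< {i = i} {j} = <ᵇ⇒< (toℕ i) (toℕ j)

<⇒<F : {i : Fin n} {j : Fin n′} → toℕ i < toℕ j → T (i <F j)
<⇒<F = <⇒<ᵇ

≤F⇒≤ : {i : Fin n} {j : Fin n′} → T (i ≤F j) → toℕ i ≤ toℕ j
≤F⇒≤ {i = i} {j} = ≤ᵇ⇒≤ (toℕ i) (toℕ j)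

≤⇒≤F : {i : Fin n} {j : Fin n′} → toℕ i ≤ toℕ j → T (i ≤F j)
≤⇒≤F = ≤⇒≤ᵇ

<ᵇ-suc : ∀ i j → i ≢ j → (i <ᵇ suc j) ≡ (i <ᵇ j)
<ᵇ-suc zero zero i≢j = ⊥-elim (i≢j refl)
<ᵇ-suc zero (suc j) _ = refl
<ᵇ-suc (suc i) zero _ = refl
<ᵇ-suc (suc i) (suc j) i≢j = <ᵇ-suc i j (i≢j ∘ cong suc)

≤ᵇ-pred : ∀ i j → i ≢ j → (suc i ≤ᵇ j) ≡ (i ≤ᵇ j)
≤ᵇ-pred zero zero i≢j = ⊥-elim (i≢j refl)
≤ᵇ-pred zero (suc j) _ = refl
≤ᵇ-pred (suc i) zero _ = refl
≤ᵇ-pred (suc i) (suc j) i≢j = sym (<ᵇ-suc i j (i≢j ∘ cong suc))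

any-allFin⁺ : (p : Fin n → Bool) (i : Fin n) → T (p i) → T (any p (allFin n))
any-allFin⁺ p i pi = any⁺ p (Any.tabulate⁺ i pi)

any-allFin⁻ : (p : Fin n → Bool) → T (any p (allFin n)) → ∃ λ i → T (p i)
any-allFin⁻ {n} p h = Any.tabulate⁻ (any⁻ p (allFin n) h)

all-allFin⁺ : (p : Fin n → Bool) → (∀ i → T (p i)) → T (all p (allFin n))
all-allFin⁺ p f = all⁻ p (All.tabulate⁺ f)

all-allFin⁻ : (p : Fin n → Bool) → T (all p (allFin n)) → ∀ i → T (p i)
all-allFin⁻ {n} p h = All.tabulate⁻ (all⁺ p (allFin n) h)

filterᵇ-cong : {p q : A → Bool} → (∀ x → p x ≡ q x) → (xs : List A) → filterᵇ p xs ≡ filterᵇ q xs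
filterᵇ-cong {p = p} {q} p≗q =
  filter-≐ (T? ∘ p) (T? ∘ q) ((λ {x} → subst T (p≗q x)) , (λ {x} → subst T (sym (p≗q x))))

-- Counting and searching in Fin n

suc-if : Bool → ℕ → ℕ
suc-if b k = if b then suc k else k

suc-if-comm : ∀ a b k → suc-if a (suc-if b k) ≡ suc-if b (suc-if a k)
suc-if-comm true true k = refl
suc-if-comm true false k = refl
suc-if-comm false b k = refl

isOdd-suc-if : ∀ b k → isOdd (suc-if b k) ≡ b xor isOdd k
isOdd-suc-if true k = refl
isOdd-suc-if false k = refl

length-filterᵇ-map : (p : X → Bool) (f : A → X) (xs : List A) →
  length (filterᵇ p (map f xs)) ≡ length (filterᵇ (p ∘ f) xs)
length-filterᵇ-map p f [] = refl
length-filterᵇ-map p f (x ∷ xs) with p (f x)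
... | true = cong suc (length-filterᵇ-map p f xs)
... | false = length-filterᵇ-map p f xs

count-cong : {p q : Fin n → Bool} → (∀ i → p i ≡ q i) → count p ≡ count q
count-cong {n} p≗q = cong length (filterᵇ-cong p≗q (allFin n))

count-tail : (p : Fin (suc n) → Bool) → length (filterᵇ p (tabulate suc)) ≡ count (p ∘ suc)
count-tail {n} p =
  trans (cong (length ∘ filterᵇ p) (sym (map-tabulate id suc))) (length-filterᵇ-map p suc (allFin n))

count-suc : (p : Fin (suc n) → Bool) → count p ≡ suc-if (p zero) (count (p ∘ suc))
count-suc p with p zero
... | true = cong suc (count-tail p)
... | false = count-tail p

count-false : count {n} (λ _ → false) ≡ 0
count-false {zero} = refl
count-false {suc n} = trans (count-suc {n} (λ _ → false)) (count-false {n})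

count-split : (P Q : Fin n → Bool) (i₀ : Fin n) → (∀ i → i ≢ i₀ → P i ≡ Q i) → Q i₀ ≡ false →
  count P ≡ suc-if (P i₀) (count Q)
count-split P Q zero P≗Q Q₀ = begin
  count P                                              ≡⟨ count-suc P ⟩
  suc-if (P zero) (count (P ∘ suc))                    ≡⟨ cong (suc-if (P zero)) (count-cong (λ i → P≗Q (suc i) λ ())) ⟩
  suc-if (P zero) (count (Q ∘ suc))                    ≡⟨ cong (λ b → suc-if (P zero) (suc-if b (count (Q ∘ suc)))) Q₀ ⟨
  suc-if (P zero) (suc-if (Q zero) (count (Q ∘ suc)))  ≡⟨ cong (suc-if (P zero)) (count-suc Q) ⟨
  suc-if (P zero) (count Q)                            ∎
  where open ≡-Reasoning
count-split P Q (suc i₀) P≗Q Q₀ = begin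
  count P                                                  ≡⟨ count-suc P ⟩
  suc-if (P zero) (count (P ∘ suc))                        ≡⟨ cong₂ suc-if (P≗Q zero λ ()) split-tail ⟩
  suc-if (Q zero) (suc-if (P (suc i₀)) (count (Q ∘ suc)))  ≡⟨ suc-if-comm (Q zero) (P (suc i₀)) (count (Q ∘ suc)) ⟩
  suc-if (P (suc i₀)) (suc-if (Q zero) (count (Q ∘ suc)))  ≡⟨ cong (suc-if (P (suc i₀))) (count-suc Q) ⟨
  suc-if (P (suc i₀)) (count Q)                            ∎
  where
  open ≡-Reasoning
  split-tail : count (P ∘ suc) ≡ suc-if (P (suc i₀)) (count (Q ∘ suc))
  split-tail = count-split (P ∘ suc) (Q ∘ suc) i₀ (λ i i≢i₀ → P≗Q (suc i) (i≢i₀ ∘ suc-injective)) Q₀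

data Least (p : X → Bool) (f : Fin n → X) : Maybe X → Set where
  none : (∀ j → ¬ T (p (f j))) → Least p f nothing
  some : ∀ i → T (p (f i)) → (∀ j → T (p (f j)) → toℕ i ≤ toℕ j) → Least p f (just (f i))

data Greatest (p : X → Bool) (f : Fin n → X) : Maybe X → Set where
  none : (∀ j → ¬ T (p (f j))) → Greatest p f nothing
  some : ∀ i → T (p (f i)) → (∀ j → T (p (f j)) → toℕ j ≤ toℕ i) → Greatest p f (just (f i))

least-tail : {p : X → Bool} {f : Fin (suc n) → X} {mx : Maybe X} →
  ¬ T (p (f zero)) → Least p (f ∘ suc) mx → Least p f mx
least-tail ¬p₀ (none ¬p) = none λ { zero → ¬p₀ ; (suc j) → ¬p j }
least-tail ¬p₀ (some i pi min) = some (suc i) pi λ { zero → ⊥-elim ∘ ¬p₀ ; (suc j) → s≤s ∘ min j }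

greatest-tail : {p : X → Bool} {f : Fin (suc n) → X} {mx : Maybe X} →
  ¬ T (p (f zero)) → Greatest p (f ∘ suc) mx → Greatest p f mx
greatest-tail ¬p₀ (none ¬p) = none λ { zero → ¬p₀ ; (suc j) → ¬p j }
greatest-tail ¬p₀ (some i pi max) = some (suc i) pi λ { zero → ⊥-elim ∘ ¬p₀ ; (suc j) → s≤s ∘ max j }

greatest-cons : {p : X → Bool} {f : Fin (suc n) → X} {mx : Maybe X} →
  T (p (f zero)) → Greatest p (f ∘ suc) mx → Greatest p f (mx <∣> just (f zero))
greatest-cons p₀ (none ¬p) = some zero p₀ λ { zero _ → z≤n ; (suc j) → ⊥-elim ∘ ¬p j }
greatest-cons p₀ (some i pi max) = some (suc i) pi λ { zero _ → z≤n ; (suc j) → s≤s ∘ max j }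

head-filterᵇ : (p : X → Bool) (f : Fin n → X) → Least p f (head (filterᵇ p (tabulate f)))
head-filterᵇ {n = zero} p f = none λ ()
head-filterᵇ {n = suc n} p f with p (f zero) in p₀
... | true = some zero (subst T (sym p₀) _) (λ _ _ → z≤n)
... | false = least-tail (subst T p₀) (head-filterᵇ p (f ∘ suc))

last-∷ : (x : X) (xs : List X) → last (x ∷ xs) ≡ last xs <∣> just x
last-∷ x [] = refl
last-∷ {X = X} x (y ∷ ys) rewrite last-∷ y ys = just-<∣> (last ys)
  where
  just-<∣> : (z : Maybe X) → z <∣> just y ≡ (z <∣> just y) <∣> just x
  just-<∣> nothing = refl
  just-<∣> (just _) = refl

last-filterᵇ : (p : X → Bool) (f : Fin n → X) → Greatest p f (last (filterᵇ p (tabulate f)))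
last-filterᵇ {n = zero} p f = none λ ()
last-filterᵇ {n = suc n} p f with p (f zero) in p₀
... | true rewrite last-∷ (f zero) (filterᵇ p (tabulate (f ∘ suc))) =
  greatest-cons (subst T (sym p₀) _) (last-filterᵇ p (f ∘ suc))
... | false = greatest-tail (subst T p₀) (last-filterᵇ p (f ∘ suc))

least-exists : (p : Fin n → Bool) (a : Fin n) → T (p a) → ∃ λ i → T (p i) × ∀ j → T (p j) → toℕ i ≤ toℕ j
least-exists {n} p a pa with head (filterᵇ p (allFin n)) | head-filterᵇ p id
... | _ | none ¬p = ⊥-elim (¬p a pa)
... | _ | some i pi min = i , pi , min

Least-unique : {p : Fin n → Bool} {mx : Maybe (Fin n)} {c : Fin n} → Least p id mx →
  T (p c) → (∀ j → T (p j) → toℕ c ≤ toℕ j) → mx ≡ just c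
Least-unique (none ¬p) pc _ = ⊥-elim (¬p _ pc)
Least-unique (some i pi min) pc min′ = cong just (toℕ-injective (ℕ.≤-antisym (min _ pc) (min′ i pi)))

Greatest-unique : {p : Fin n → Bool} {mx : Maybe (Fin n)} {c : Fin n} → Greatest p id mx →
  T (p c) → (∀ j → T (p j) → toℕ j ≤ toℕ c) → mx ≡ just c
Greatest-unique (none ¬p) pc _ = ⊥-elim (¬p _ pc)
Greatest-unique (some i pi max) pc max′ = cong just (toℕ-injective (ℕ.≤-antisym (max′ i pi) (max _ pc)))

Least-just : {p : X → Bool} {f : Fin n → X} {x : X} → Least p f (just x) → T (p x)
Least-just (some _ px _) = px

Greatest-just : {p : X → Bool} {f : Fin n → X} {x : X} → Greatest p f (just x) → T (p x)
Greatest-just (some _ px _) = px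

-- Edges of a star network

module _ (F : StarNet n m) where

  nextTouch-least : (w : Fin n) (g : Fin (suc m)) →
    Least (λ c → (g ≤F c) ∧ touches F c w) id (nextTouch F w g)
  nextTouch-least w g = head-filterᵇ _ id

  prevTouch-greatest : (w : Fin n) (g : Fin (suc m)) →
    Greatest (λ c → (c <F g) ∧ touches F c w) id (prevTouch F w g)
  prevTouch-greatest w g = last-filterᵇ _ id

  nextTouch-touches : ∀ {w c} g → nextTouch F w g ≡ just c → T (touches F c w)
  nextTouch-touches {w} {c} g e = ∧-elimʳ {g ≤F c} (Least-just (subst (Least _ id) e (nextTouch-least w g)))

  prevTouch-touches : ∀ {w c} g → prevTouch F w g ≡ just c → T (touches F c w)
  prevTouch-touches {w} {c} g e = ∧-elimʳ {c <F g} (Greatest-just (subst (Greatest _ id) e (prevTouch-greatest w g)))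

  nextTouch-entering : ∀ {w c} → T (touches F c w) → nextTouch F w (inject₁ c) ≡ just c
  nextTouch-entering {w} {c} tc = Least-unique (nextTouch-least w (inject₁ c))
    (∧-intro (≤⇒≤F (ℕ.≤-reflexive (toℕ-inject₁ c))) tc)
    (λ d h → subst (_≤ toℕ d) (toℕ-inject₁ c) (≤F⇒≤ (∧-elimˡ h)))

  prevTouch-leaving : ∀ {w c} → T (touches F c w) → prevTouch F w (suc c) ≡ just c
  prevTouch-leaving {w} {c} tc = Greatest-unique (prevTouch-greatest w (suc c))
    (∧-intro (<⇒<F {i = c} {j = suc {m} c} ℕ.≤-refl) tc)
    (λ d h → ℕ.≤-pred (<F⇒< {i = d} {j = suc {m} c} (∧-elimˡ h)))

  prevTouch-source : (w : Fin n) → prevTouch F w zero ≡ nothing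
  prevTouch-source w with prevTouch F w zero | prevTouch-greatest w zero
  ... | _ | none _ = refl
  ... | _ | some _ () _

  module _ {c : Fin m} {w : Fin n} (¬tc : ¬ T (touches F c w)) where

    touches⇒≢ : ∀ {d} → T (touches F d w) → toℕ d ≢ toℕ c
    touches⇒≢ td d≡c = ¬tc (subst (λ e → T (touches F e w)) (toℕ-injective d≡c) td)

    prevTouch-across : prevTouch F w (suc c) ≡ prevTouch F w (inject₁ c)
    prevTouch-across = cong last (filterᵇ-cong (λ d → ∧-congʳ λ td →
      trans (<ᵇ-suc (toℕ d) (toℕ c) (touches⇒≢ td)) (cong (toℕ d <ᵇ_) (sym (toℕ-inject₁ c)))) (allFin m))

    nextTouch-across : nextTouch F w (suc c) ≡ nextTouch F w (inject₁ c)
    nextTouch-across = cong head (filterᵇ-cong (λ d → ∧-congʳ λ td →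
      trans (≤ᵇ-pred (toℕ c) (toℕ d) (touches⇒≢ td ∘ sym)) (cong (_≤ᵇ toℕ d) (sym (toℕ-inject₁ c)))) (allFin m))

data SameEdge (F : StarNet n m) (g : Fin (suc m)) (w w′ : Fin n) : Set where
  same-wire : w ≡ w′ → SameEdge F g w w′
  parallel  : (l c : Fin m) → prevTouch F w g ≡ just l → nextTouch F w g ≡ just c →
              prevTouch F w′ g ≡ just l → nextTouch F w′ g ≡ just c → T (merged F l c) →
              SameEdge F g w w′

module _ (F : StarNet n m) (g : Fin (suc m)) where

  sameEdge-refl : (w : Fin n) → T (sameEdge F w w g)
  sameEdge-refl w with prevTouch F w g | nextTouch F w g
  ... | just _ | just _ = ∨-introˡ (≡F-refl w)
  ... | just _ | nothing = ≡F-refl w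
  ... | nothing | _ = ≡F-refl w

  sameEdge⇒SameEdge : ∀ {w w′} → T (sameEdge F w w′ g) → SameEdge F g w w′
  sameEdge⇒SameEdge {w} {w′} h
    with prevTouch F w g in e₁ | nextTouch F w g in e₂ | prevTouch F w′ g in e₃ | nextTouch F w′ g in e₄
  ... | just l | just c | just l′ | just c′ with ∨-elim {w ≡F w′} h
  ...   | inj₁ w≡w′ = same-wire (≡F⇒≡ w≡w′)
  ...   | inj₂ h′ with ≡F⇒≡ {i = l} (∧-elimˡ h′) | ≡F⇒≡ {i = c} (∧-elimˡ (∧-elimʳ {l ≡F l′} h′))
  ...     | refl | refl = parallel l c e₁ e₂ e₃ e₄ (∧-elimʳ {c ≡F c} (∧-elimʳ {l ≡F l} h′))
  sameEdge⇒SameEdge h | nothing | _ | _ | _ = same-wire (≡F⇒≡ h)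
  sameEdge⇒SameEdge h | just _ | nothing | _ | _ = same-wire (≡F⇒≡ h)
  sameEdge⇒SameEdge h | just _ | just _ | nothing | _ = same-wire (≡F⇒≡ h)
  sameEdge⇒SameEdge h | just _ | just _ | just _ | nothing = same-wire (≡F⇒≡ h)

  SameEdge⇒sameEdge : ∀ {w w′} → SameEdge F g w w′ → T (sameEdge F w w′ g)
  SameEdge⇒sameEdge (same-wire refl) = sameEdge-refl _
  SameEdge⇒sameEdge {w} {w′} (parallel l c e₁ e₂ e₃ e₄ lc) rewrite e₁ | e₂ | e₃ | e₄ =
    ∨-introʳ {w ≡F w′} (∧-intro (≡F-refl l) (∧-intro (≡F-refl c) lc))

  SameEdge-sym : ∀ {w w′} → SameEdge F g w w′ → SameEdge F g w′ w
  SameEdge-sym (same-wire e) = same-wire (sym e)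
  SameEdge-sym (parallel l c e₁ e₂ e₃ e₄ lc) = parallel l c e₃ e₄ e₁ e₂ lc

  SameEdge-trans : ∀ {u v w} → SameEdge F g u v → SameEdge F g v w → SameEdge F g u w
  SameEdge-trans (same-wire refl) vw = vw
  SameEdge-trans uv (same-wire refl) = uv
  SameEdge-trans (parallel l c e₁ e₂ e₃ e₄ lc) (parallel _ _ f₁ f₂ f₃ f₄ _) =
    parallel l c e₁ e₂ (trans f₃ (trans (sym f₁) e₃)) (trans f₄ (trans (sym f₂) e₄)) lc

  sameEdge-sym : ∀ {w w′} → T (sameEdge F w w′ g) → T (sameEdge F w′ w g)
  sameEdge-sym = SameEdge⇒sameEdge ∘ SameEdge-sym ∘ sameEdge⇒SameEdge

  sameEdge-trans : ∀ {u v w} → T (sameEdge F u v g) → T (sameEdge F v w g) → T (sameEdge F u w g)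
  sameEdge-trans uv vw = SameEdge⇒sameEdge (SameEdge-trans (sameEdge⇒SameEdge uv) (sameEdge⇒SameEdge vw))

module _ (F : StarNet n m) where

  sameEdge-source : ∀ {w w′} → T (sameEdge F w w′ zero) → w ≡ w′
  sameEdge-source {w} h with sameEdge⇒SameEdge F zero h
  ... | same-wire e = e
  ... | parallel _ _ e₁ _ _ _ _ with trans (sym (prevTouch-source F w)) e₁
  ...   | ()

  sameEdge-touches-entering : ∀ {c u w} → T (sameEdge F u w (inject₁ c)) → T (touches F c w) → T (touches F c u)
  sameEdge-touches-entering {c} h tw with sameEdge⇒SameEdge F (inject₁ c) h
  ... | same-wire refl = tw
  ... | parallel _ _ _ e₂ _ e₄ _ with trans (sym e₄) (nextTouch-entering F tw)
  ...   | refl = nextTouch-touches F (inject₁ c) e₂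

  sameEdge-touches-leaving : ∀ {c u w} → T (sameEdge F u w (suc c)) → T (touches F c w) → T (touches F c u)
  sameEdge-touches-leaving {c} h tw with sameEdge⇒SameEdge F (suc c) h
  ... | same-wire refl = tw
  ... | parallel _ _ e₁ _ e₃ _ _ with trans (sym e₃) (prevTouch-leaving F tw)
  ...   | refl = prevTouch-touches F (suc c) e₁

  apart-entering : ∀ {c u w} → T (touches F c u) → ¬ T (touches F c w) → ¬ T (sameEdge F u w (inject₁ c))
  apart-entering {c} tu ¬tw h = ¬tw (sameEdge-touches-entering (sameEdge-sym F (inject₁ c) h) tu)

  apart-leaving : ∀ {c u w} → T (touches F c u) → ¬ T (touches F c w) → ¬ T (sameEdge F u w (suc c))
  apart-leaving {c} tu ¬tw h = ¬tw (sameEdge-touches-leaving (sameEdge-sym F (suc c) h) tu)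

  sameEdge-across : ∀ {c w} → ¬ T (touches F c w) → ∀ u → sameEdge F u w (suc c) ≡ sameEdge F u w (inject₁ c)
  sameEdge-across {c} {w} ¬tw u with T? (touches F c u)
  ... | yes tu = trans (¬T⇒≡false (apart-leaving tu ¬tw)) (sym (¬T⇒≡false (apart-entering tu ¬tw)))
  ... | no ¬tu rewrite prevTouch-across F ¬tu | nextTouch-across F ¬tu
                     | prevTouch-across F ¬tw | nextTouch-across F ¬tw = refl

-- Vertical order of edges

-- belowAt F g w w′ is definitionally below (edgeOf F g w) (edgeOf F g w′).
below : (Fin n → Bool) → (Fin n → Bool) → Bool
below {n} P Q = any (λ u → P u ∧ all (λ u′ → not (Q u′) ∨ (u <F u′)) (allFin n)) (allFin n)

Below : (Fin n → Bool) → (Fin n → Bool) → Set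
Below P Q = ∃ λ u → T (P u) × ∀ u′ → T (Q u′) → toℕ u < toℕ u′

module _ {P Q : Fin n → Bool} where

  below⇒Below : T (below P Q) → Below P Q
  below⇒Below h with any-allFin⁻ _ h
  ... | u , h′ = u , ∧-elimˡ h′ , λ u′ qu′ → <F⇒< (lt (∨-elim (all-allFin⁻ _ (∧-elimʳ {P u} h′) u′)) qu′)
    where
    lt : ∀ {u′} → T (not (Q u′)) ⊎ T (u <F u′) → T (Q u′) → T (u <F u′)
    lt (inj₁ ¬qu′) qu′ = ⊥-elim (not-elim ¬qu′ qu′)
    lt (inj₂ u<u′) _ = u<u′

  Below⇒below : Below P Q → T (below P Q)
  Below⇒below (u , pu , u<Q) = any-allFin⁺ _ u (∧-intro pu (all-allFin⁺ _ above))
    where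
    above : ∀ u′ → T (not (Q u′) ∨ (u <F u′))
    above u′ with T? (Q u′)
    ... | yes qu′ = ∨-introʳ {not (Q u′)} (<⇒<F (u<Q u′ qu′))
    ... | no ¬qu′ = ∨-introˡ (not-intro ¬qu′)

  Below-asym : Below P Q → ¬ Below Q P
  Below-asym (u , pu , u<Q) (v , qv , v<P) = ℕ.<-asym (u<Q v qv) (v<P u pu)

  -- the lowest wire of P ∪ Q decides
  Below-total : (∀ u → T (P u) → ¬ T (Q u)) → ∀ {a b} → T (P a) → T (Q b) → Below P Q ⊎ Below Q P
  Below-total disjoint {a} pa _ with least-exists (λ u → P u ∨ Q u) a (∨-introˡ pa)
  ... | u , pqu , min with ∨-elim {P u} pqu
  ...   | inj₁ pu = inj₁ (u , pu , λ u′ qu′ → ℕ.≤∧≢⇒< (min u′ (∨-introʳ {P u′} qu′))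
                              λ u≡u′ → disjoint u pu (subst (T ∘ Q) (sym (toℕ-injective u≡u′)) qu′))
  ...   | inj₂ qu = inj₂ (u , qu , λ u′ pu′ → ℕ.≤∧≢⇒< (min u′ (∨-introˡ pu′))
                              λ u≡u′ → disjoint u (subst (T ∘ P) (sym (toℕ-injective u≡u′)) pu′) qu)

  Below-transport : {P′ Q′ : Fin n → Bool} → (∀ u → T (P u) → T (P′ u)) → (∀ u → T (Q′ u) → T (Q u)) →
    Below P Q → Below P′ Q′
  Below-transport P⊆P′ Q′⊆Q (u , pu , u<Q) = u , P⊆P′ u pu , λ u′ → u<Q u′ ∘ Q′⊆Q u′

below-cong : {P P′ Q Q′ : Fin n → Bool} → (∀ u → P u ≡ P′ u) → (∀ u → Q u ≡ Q′ u) → below P Q ≡ below P′ Q′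
below-cong P≗P′ Q≗Q′ =
  T-ext (Below⇒below ∘ Below-transport (λ u → subst T (P≗P′ u)) (λ u → subst T (sym (Q≗Q′ u))) ∘ below⇒Below)
        (Below⇒below ∘ Below-transport (λ u → subst T (sym (P≗P′ u))) (λ u → subst T (Q≗Q′ u)) ∘ below⇒Below)

Inside : Interval n → Fin n → Set
Inside I u = T ((Interval.lo I ≤F u) ∧ (u ≤F Interval.hi I))

Below-interval : (I : Interval n) {P Q : Fin n → Bool} → (∀ u → T (P u) → Inside I u) →
  (∀ u → T (Q u) → ¬ Inside I u) → ∀ {a} → T (P a) →
  Below P Q ⇔ (∀ u′ → T (Q u′) → toℕ (Interval.hi I) < toℕ u′)
Below-interval I {P} {Q} P⊆I Q∩I≡∅ {a} pa =
  mk⇔ above-hi (λ hi<Q → a , pa , λ u′ qu′ → ℕ.≤-<-trans (≤hi a pa) (hi<Q u′ qu′))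
  where
  open Interval I
  ≤hi : ∀ u → T (P u) → toℕ u ≤ toℕ hi
  ≤hi u pu = ≤F⇒≤ {i = u} {j = hi} (∧-elimʳ {lo ≤F u} (P⊆I u pu))
  above-hi : Below P Q → ∀ u′ → T (Q u′) → toℕ hi < toℕ u′
  above-hi (u , pu , u<Q) u′ qu′ = ℕ.≰⇒> λ u′≤hi → Q∩I≡∅ u′ qu′ (∧-intro
    (≤⇒≤F {i = lo} {j = u′} (ℕ.≤-trans (≤F⇒≤ {i = lo} {j = u} (∧-elimˡ (P⊆I u pu))) (ℕ.<⇒≤ (u<Q u′ qu′))))
    (≤⇒≤F {i = u′} {j = hi} u′≤hi))

module _ (F : StarNet n m) where

  edgeOf : Fin (suc m) → Fin n → Fin n → Bool
  edgeOf g w u = sameEdge F u w g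

  belowAt⇒Below : ∀ g w w′ → T (belowAt F g w w′) → Below (edgeOf g w) (edgeOf g w′)
  belowAt⇒Below _ _ _ = below⇒Below

  Below⇒belowAt : ∀ g w w′ → Below (edgeOf g w) (edgeOf g w′) → T (belowAt F g w w′)
  Below⇒belowAt _ _ _ = Below⇒below

  belowAt-flip : ∀ g {w w′} → ¬ T (sameEdge F w w′ g) → belowAt F g w′ w ≡ not (belowAt F g w w′)
  belowAt-flip g {w} {w′} ¬w~w′ =
    ≡not (λ (w<w′ , w′<w) → Below-asym (belowAt⇒Below g w w′ w<w′) (belowAt⇒Below g w′ w w′<w))
         (Sum.map (Below⇒belowAt g w w′) (Below⇒belowAt g w′ w)
           (Below-total disjoint (sameEdge-refl F g w) (sameEdge-refl F g w′)))
    where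
    disjoint : ∀ u → T (sameEdge F u w g) → ¬ T (sameEdge F u w′ g)
    disjoint u u~w u~w′ = ¬w~w′ (sameEdge-trans F g (sameEdge-sym F g u~w) u~w′)

  -- Both sides say that the edge of w′ lies above the interval of x_c.
  belowAt-across : ∀ {c w v w′} → T (touches F c w) → T (touches F c v) → ¬ T (touches F c w′) →
    belowAt F (inject₁ c) w w′ ≡ belowAt F (suc c) v w′
  belowAt-across {c} {w} {v} {w′} tw tv ¬tw′ = T-ext
    (λ h → Below⇒belowAt (suc c) v w′ (Equivalence.from leaving λ u′ u′~w′ →
      Equivalence.to entering (belowAt⇒Below (inject₁ c) w w′ h) u′ (subst T (sameEdge-across F ¬tw′ u′) u′~w′)))
    (λ h → Below⇒belowAt (inject₁ c) w w′ (Equivalence.from entering λ u′ u′~w′ →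
      Equivalence.to leaving (belowAt⇒Below (suc c) v w′ h) u′ (subst T (sym (sameEdge-across F ¬tw′ u′)) u′~w′)))
    where
    open Interval (intervalOf F c)
    entering : Below (edgeOf (inject₁ c) w) (edgeOf (inject₁ c) w′) ⇔
               (∀ u′ → T (edgeOf (inject₁ c) w′ u′) → toℕ hi < toℕ u′)
    entering = Below-interval (intervalOf F c) (λ u u~w → sameEdge-touches-entering F u~w tw)
      (λ u u~w′ tu → apart-entering F tu ¬tw′ u~w′) (sameEdge-refl F (inject₁ c) w)
    leaving : Below (edgeOf (suc c) v) (edgeOf (suc c) w′) ⇔
              (∀ u′ → T (edgeOf (suc c) w′ u′) → toℕ hi < toℕ u′)
    leaving = Below-interval (intervalOf F c) (λ u u~v → sameEdge-touches-leaving F u~v tv)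
      (λ u u~w′ tu → apart-leaving F tu ¬tw′ u~w′) (sameEdge-refl F (suc c) v)

shareEdge runsBelow : StarNet n m → WirePath n m → WirePath n m → Fin (suc m) → Bool
shareEdge F p q g = sameEdge F (p g) (q g) g
runsBelow F p q g = belowAt F g (p g) (q g)

module _ (F : StarNet n m) (c : Fin m) where

  private
    one-visits : ∀ {p q} → IsPath F p → IsPath F q → T (visits F p c) → ¬ T (visits F q c) →
      ¬ T (shareEdge F p q (suc c)) × ¬ T (shareEdge F p q (inject₁ c)) ×
      runsBelow F p q (suc c) ≡ runsBelow F p q (inject₁ c)
    one-visits {p} {q} isp isq tp ¬tq rewrite proj₂ (isq c) ¬tq =
      apart-leaving F tp′ ¬tq , apart-entering F tp ¬tq , sym (belowAt-across F tp tp′ ¬tq)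
      where
      tp′ : T (touches F c (p (suc c)))
      tp′ = proj₁ (isp c) tp

  positions-across : ∀ {p q} → IsPath F p → IsPath F q → ¬ T (visits F p c ∧ visits F q c) →
    shareEdge F p q (suc c) ≡ shareEdge F p q (inject₁ c) × runsBelow F p q (suc c) ≡ runsBelow F p q (inject₁ c)
  positions-across {p} {q} isp isq ¬both with T? (visits F p c) | T? (visits F q c)
  ... | yes tp | yes tq = ⊥-elim (¬both (∧-intro tp tq))
  ... | yes tp | no ¬tq with one-visits {p} {q} isp isq tp ¬tq
  ...   | ¬E′ , ¬E , B′≡B = trans (¬T⇒≡false ¬E′) (sym (¬T⇒≡false ¬E)) , B′≡B
  positions-across {p} {q} isp isq ¬both | no ¬tp | yes tq with one-visits {q} {p} isq isp tq ¬tp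
  ...   | ¬E′ , ¬E , B′≡B =
    trans (¬T⇒≡false (¬E′ ∘ sameEdge-sym F (suc c))) (sym (¬T⇒≡false (¬E ∘ sameEdge-sym F (inject₁ c)))) ,
    (begin
      runsBelow F p q (suc c)              ≡⟨ belowAt-flip F (suc c) ¬E′ ⟩
      not (runsBelow F q p (suc c))        ≡⟨ cong not B′≡B ⟩
      not (runsBelow F q p (inject₁ c))    ≡⟨ belowAt-flip F (inject₁ c) ¬E ⟨
      runsBelow F p q (inject₁ c)          ∎)
    where open ≡-Reasoning
  positions-across {p} {q} isp isq ¬both | no ¬tp | no ¬tq
    rewrite proj₂ (isp c) ¬tp | proj₂ (isq c) ¬tq =
    sameEdge-across F ¬tq (p (inject₁ c)) , below-cong (sameEdge-across F ¬tp) (sameEdge-across F ¬tq)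

-- Parity of crossings

-- Two paths are abstracted to: whether each visits x_c (vp, vq) and, in each gap g, whether they
-- share an edge (E) and whether the edge of the first lies below (B) or above (B′) that of the
-- second.  Instantiated with two paths, meetsA, compEndA, crossingA and crossingsBeforeA unfold to
-- meets, compEnd, crossing and crossingsBefore.
module CrossingParity {m : ℕ} (vp vq : Fin m → Bool) (E B B′ : Fin (suc m) → Bool)
  (unchanged : ∀ c → ¬ T (vp c ∧ vq c) → E (suc c) ≡ E (inject₁ c) × B (suc c) ≡ B (inject₁ c))
  (B′≡not : ∀ g → ¬ T (E g) → B′ g ≡ not (B g))
  (E₀ : ¬ T (E zero)) (B₀ : T (B zero)) where

  meetsA : Fin m → Bool
  meetsA c = vp c ∧ vq c ∧ not (E (inject₁ c))

  noMeetBetween : Fin m → Fin m → Bool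
  noMeetBetween c ℓ = all (λ d → not ((c <F d) ∧ (d ≤F ℓ) ∧ meetsA d)) (allFin m)

  compEndA : Fin m → Fin m → Bool
  compEndA c ℓ = meetsA c ∧ (c ≤F ℓ) ∧ vp ℓ ∧ vq ℓ ∧ not (E (suc ℓ)) ∧ noMeetBetween c ℓ

  crossingA : Fin m → Fin m → Bool
  crossingA c ℓ = compEndA c ℓ ∧ ((B (inject₁ c) ∧ B′ (suc ℓ)) ∨ (B′ (inject₁ c) ∧ B (suc ℓ)))

  crossesFrom : Fin m → Bool
  crossesFrom c = any (crossingA c) (allFin m)

  crossingsBeforeA : ∀ {k} → Fin k → ℕ
  crossingsBeforeA g = count (λ c → (c <F g) ∧ crossesFrom c)

  record Component (c ℓ : Fin m) : Set where
    field
      meets-start : T (meetsA c)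
      start≤end : toℕ c ≤ toℕ ℓ
      visits-end : T (vp ℓ ∧ vq ℓ)
      apart-after : ¬ T (E (suc ℓ))
      no-meet-inside : ∀ d → toℕ c < toℕ d → toℕ d ≤ toℕ ℓ → ¬ T (meetsA d)

  compEndA⇒Component : ∀ {c ℓ} → T (compEndA c ℓ) → Component c ℓ
  compEndA⇒Component {c} {ℓ} h = record
    { meets-start = ∧-elimˡ h
    ; start≤end = ≤F⇒≤ {i = c} {j = ℓ} (∧-elimˡ h₁)
    ; visits-end = ∧-intro {vp ℓ} (∧-elimˡ h₂) (∧-elimˡ h₃)
    ; apart-after = not-elim (∧-elimˡ h₄)
    ; no-meet-inside = λ d c<d d≤ℓ md → not-elim (all-allFin⁻ _ (∧-elimʳ {not (E (suc ℓ))} h₄) d)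
        (∧-intro (<⇒<F {i = c} {j = d} c<d) (∧-intro (≤⇒≤F {i = d} {j = ℓ} d≤ℓ) md))
    }
    where
    h₁ : T ((c ≤F ℓ) ∧ vp ℓ ∧ vq ℓ ∧ not (E (suc ℓ)) ∧ noMeetBetween c ℓ)
    h₁ = ∧-elimʳ {meetsA c} h
    h₂ : T (vp ℓ ∧ vq ℓ ∧ not (E (suc ℓ)) ∧ noMeetBetween c ℓ)
    h₂ = ∧-elimʳ {c ≤F ℓ} h₁
    h₃ : T (vq ℓ ∧ not (E (suc ℓ)) ∧ noMeetBetween c ℓ)
    h₃ = ∧-elimʳ {vp ℓ} h₂
    h₄ : T (not (E (suc ℓ)) ∧ noMeetBetween c ℓ)
    h₄ = ∧-elimʳ {vq ℓ} h₃

  Component⇒compEndA : ∀ {c ℓ} → Component c ℓ → T (compEndA c ℓ)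
  Component⇒compEndA {c} {ℓ} K =
    ∧-intro meets-start (∧-intro (≤⇒≤F {i = c} {j = ℓ} start≤end) (∧-intro {vp ℓ} (∧-elimˡ visits-end)
      (∧-intro (∧-elimʳ {vp ℓ} visits-end) (∧-intro (not-intro apart-after) (all-allFin⁺ _ λ d → not-intro λ h →
        no-meet-inside d (<F⇒< {i = c} {j = d} (∧-elimˡ h)) (≤F⇒≤ {i = d} {j = ℓ} (∧-elimˡ (∧-elimʳ {c <F d} h)))
          (∧-elimʳ {d ≤F ℓ} (∧-elimʳ {c <F d} h)))))))
    where open Component K

  meets-intro : ∀ {c} → T (vp c ∧ vq c) → ¬ T (E (inject₁ c)) → T (meetsA c)
  meets-intro {c} both ¬e = ∧-intro {vp c} (∧-elimˡ {vp c} both) (∧-intro (∧-elimʳ {vp c} both) (not-intro ¬e))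

  meets⇒both : ∀ {c} → T (meetsA c) → T (vp c ∧ vq c)
  meets⇒both {c} mc = ∧-intro {vp c} (∧-elimˡ mc) (∧-elimˡ (∧-elimʳ {vp c} mc))

  shared⇒¬meets : ∀ {c} → T (E (inject₁ c)) → ¬ T (meetsA c)
  shared⇒¬meets {c} e mc = not-elim (∧-elimʳ {vq c} (∧-elimʳ {vp c} mc)) e

  ¬meets⇒¬crossesFrom : ∀ {c} → ¬ T (meetsA c) → ¬ T (crossesFrom c)
  ¬meets⇒¬crossesFrom {c} ¬mc h with any-allFin⁻ _ h
  ... | ℓ , cr = ¬mc (∧-elimˡ (∧-elimˡ {compEndA c ℓ} cr))

  both-visit : ∀ c → ¬ T (E (inject₁ c)) → T (E (suc c)) → T (vp c ∧ vq c)
  both-visit c ¬e e′ with T? (vp c ∧ vq c)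
  ... | yes both = both
  ... | no ¬both = ⊥-elim (¬e (subst T (proj₁ (unchanged c ¬both)) e′))

  record SeparatedBefore (g : Fin (suc m)) : Set where
    field
      start : Fin m
      start<g : toℕ start < toℕ g
      apart : ¬ T (E (inject₁ start))
      shared : ∀ h → toℕ start < toℕ h → toℕ h < toℕ g → T (E h)

  separated-before : ∀ ℓ → SeparatedBefore (suc ℓ)
  separated-before ℓ =
    extend ℓ (<-weakInduction (λ g → T (E g) → SeparatedBefore g) (⊥-elim ∘ E₀) (λ j ih _ → extend j ih) (inject₁ ℓ))
    where
    extend : ∀ j → (T (E (inject₁ j)) → SeparatedBefore (inject₁ j)) → SeparatedBefore (suc j)
    extend j ih with T? (E (inject₁ j))
    ... | no ¬e = record
      { start = j ; start<g = ℕ.n<1+n (toℕ j) ; apart = ¬e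
      ; shared = λ h j<h h≤j → ⊥-elim (ℕ.<⇒≱ j<h (s≤s⁻¹ h≤j)) }
    ... | yes e = record { start = start ; start<g = start<1+j ; apart = apart ; shared = shared′ }
      where
      open SeparatedBefore (ih e)
      start<1+j : toℕ start < suc (toℕ j)
      start<1+j = ℕ.m<n⇒m<1+n (subst (toℕ start <_) (toℕ-inject₁ j) start<g)
      shared′ : ∀ h → toℕ start < toℕ h → toℕ h < suc (toℕ j) → T (E h)
      shared′ h s<h h≤j with ℕ.m≤n⇒m<n∨m≡n (s≤s⁻¹ h≤j)
      ... | inj₁ h<j = shared h s<h (subst (toℕ h <_) (sym (toℕ-inject₁ j)) h<j)
      ... | inj₂ h≡j = subst (T ∘ E) (toℕ-injective (trans (toℕ-inject₁ j) (sym h≡j))) e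

  module Start (ℓ : Fin m) = SeparatedBefore (separated-before ℓ)
  open Start using (start; shared; apart)

  start≤ℓ : ∀ ℓ → toℕ (start ℓ) ≤ toℕ ℓ
  start≤ℓ ℓ = s≤s⁻¹ (Start.start<g ℓ)

  start-meets : ∀ ℓ → T (vp ℓ ∧ vq ℓ) → T (meetsA (start ℓ))
  start-meets ℓ both with ℕ.m≤n⇒m<n∨m≡n (start≤ℓ ℓ)
  ... | inj₁ s<ℓ = meets-intro (both-visit (start ℓ) (apart ℓ) (shared ℓ (suc (start ℓ)) ℕ.≤-refl (s≤s s<ℓ))) (apart ℓ)
  ... | inj₂ s≡ℓ with start ℓ | apart ℓ | toℕ-injective s≡ℓ
  ...   | _ | apart-ℓ | refl = meets-intro both apart-ℓ

  component-end-unique : ∀ ℓ → ¬ T (E (suc ℓ)) → ∀ {ℓ′} → Component (start ℓ) ℓ′ → toℕ ℓ′ ≡ toℕ ℓ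
  component-end-unique ℓ ¬e {ℓ′} K with ℕ.<-cmp (toℕ ℓ′) (toℕ ℓ)
  ... | tri≈ _ ℓ′≡ℓ _ = ℓ′≡ℓ
  ... | tri< ℓ′<ℓ _ _ = ⊥-elim (apart-after (shared ℓ (suc ℓ′) (s≤s start≤end) (s≤s ℓ′<ℓ)))
    where open Component K
  -- The paths are apart after x_ℓ, so start ℓ′, which is a meeting, lies inside (start ℓ, ℓ′].
  ... | tri> _ _ ℓ<ℓ′ with ℕ.≤-<-connex (toℕ (start ℓ′)) (toℕ (start ℓ))
  ...   | inj₁ s′≤s = ⊥-elim (¬e (shared ℓ′ (suc ℓ) (s≤s (ℕ.≤-trans s′≤s (start≤ℓ ℓ))) (s≤s ℓ<ℓ′)))
  ...   | inj₂ s<s′ = ⊥-elim (Component.no-meet-inside K _ s<s′ (start≤ℓ ℓ′) (start-meets ℓ′ (Component.visits-end K)))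

  shared-inside : ∀ ℓ d → toℕ (start ℓ) < toℕ d → toℕ d ≤ toℕ ℓ → T (E (inject₁ d))
  shared-inside ℓ d s<d d≤ℓ = shared ℓ (inject₁ d)
    (subst (toℕ (start ℓ) <_) (sym (toℕ-inject₁ d)) s<d) (s≤s (subst (_≤ toℕ ℓ) (sym (toℕ-inject₁ d)) d≤ℓ))

  crossing-at-start : ∀ ℓ → T (vp ℓ ∧ vq ℓ) → ¬ T (E (suc ℓ)) →
    crossesFrom (start ℓ) ≡ B (inject₁ (start ℓ)) xor B (suc ℓ)
  crossing-at-start ℓ both ¬e = T-ext crossing⇒xor xor⇒crossing
    where
    s : Fin m
    s = start ℓ
    K : Component s ℓ
    K = record
      { meets-start = start-meets ℓ both ; start≤end = start≤ℓ ℓ ; visits-end = both ; apart-after = ¬e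
      ; no-meet-inside = λ d s<d d≤ℓ → shared⇒¬meets (shared-inside ℓ d s<d d≤ℓ) }
    sides : ((B (inject₁ s) ∧ B′ (suc ℓ)) ∨ (B′ (inject₁ s) ∧ B (suc ℓ))) ≡ B (inject₁ s) xor B (suc ℓ)
    sides = trans (cong₂ (λ x y → (B (inject₁ s) ∧ x) ∨ (y ∧ B (suc ℓ))) (B′≡not _ ¬e) (B′≡not _ (apart ℓ)))
                  (exactly-one≡xor (B (inject₁ s)) (B (suc ℓ)))
    crossing⇒xor : T (crossesFrom s) → T (B (inject₁ s) xor B (suc ℓ))
    crossing⇒xor h with any-allFin⁻ _ h
    ... | ℓ′ , cr with toℕ-injective (component-end-unique ℓ ¬e (compEndA⇒Component (∧-elimˡ {compEndA s ℓ′} cr)))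
    ...   | refl = subst T sides (∧-elimʳ {compEndA s ℓ} cr)
    xor⇒crossing : T (B (inject₁ s) xor B (suc ℓ)) → T (crossesFrom s)
    xor⇒crossing x = any-allFin⁺ _ ℓ (∧-intro (Component⇒compEndA K) (subst T (sym sides) x))

  crossingsBefore-step : ∀ (c₀ ℓ : Fin m) → toℕ c₀ ≤ toℕ ℓ →
    (∀ (d : Fin m) → toℕ c₀ < toℕ d → toℕ d ≤ toℕ ℓ → ¬ T (crossesFrom d)) →
    crossingsBeforeA (suc ℓ) ≡ suc-if (crossesFrom c₀) (crossingsBeforeA (inject₁ c₀))
  crossingsBefore-step c₀ ℓ c₀≤ℓ quiet = trans (count-split P Q c₀ P≗Q Q₀) (cong (λ b → suc-if b _) P₀)
    where
    P Q : Fin m → Bool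
    P c = (c <F suc ℓ) ∧ crossesFrom c
    Q c = (c <F inject₁ c₀) ∧ crossesFrom c
    P₀ : P c₀ ≡ crossesFrom c₀
    P₀ = cong (_∧ crossesFrom c₀) (T⇒≡true (<⇒<F {i = c₀} {j = suc ℓ} (s≤s c₀≤ℓ)))
    Q₀ : Q c₀ ≡ false
    Q₀ = cong (_∧ crossesFrom c₀) (¬T⇒≡false λ h → ℕ.<-irrefl (sym (toℕ-inject₁ c₀)) (<F⇒< {i = c₀} {j = inject₁ c₀} h))
    P≗Q : ∀ c → c ≢ c₀ → P c ≡ Q c
    P≗Q c c≢c₀ = T-ext P⇒Q Q⇒P
      where
      P⇒Q : T (P c) → T (Q c)
      P⇒Q h with ℕ.≤-<-connex (toℕ c) (toℕ c₀)
      ... | inj₁ c≤c₀ = ∧-intro (<⇒<F {i = c} {j = inject₁ c₀} (subst (toℕ c <_) (sym (toℕ-inject₁ c₀))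
                          (ℕ.≤∧≢⇒< c≤c₀ (c≢c₀ ∘ toℕ-injective)))) (∧-elimʳ {c <F suc ℓ} h)
      ... | inj₂ c₀<c = ⊥-elim (quiet c c₀<c (s≤s⁻¹ (<F⇒< {i = c} {j = suc ℓ} (∧-elimˡ h))) (∧-elimʳ {c <F suc ℓ} h))
      Q⇒P : T (Q c) → T (P c)
      Q⇒P h = ∧-intro (<⇒<F {i = c} {j = suc ℓ} (s≤s (ℕ.≤-trans (ℕ.<⇒≤ (subst (toℕ c <_) (toℕ-inject₁ c₀)
                (<F⇒< {i = c} {j = inject₁ c₀} (∧-elimˡ h)))) c₀≤ℓ))) (∧-elimʳ {c <F inject₁ c₀} h)

  invariant-step : ∀ (c₀ ℓ : Fin m) → toℕ c₀ ≤ toℕ ℓ →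
    (∀ (d : Fin m) → toℕ c₀ < toℕ d → toℕ d ≤ toℕ ℓ → ¬ T (crossesFrom d)) →
    crossesFrom c₀ ≡ B (inject₁ c₀) xor B (suc ℓ) →
    B (inject₁ c₀) ≡ not (isOdd (crossingsBeforeA (inject₁ c₀))) →
    B (suc ℓ) ≡ not (isOdd (crossingsBeforeA (suc ℓ)))
  invariant-step c₀ ℓ c₀≤ℓ quiet X≡xor inv = begin
    B (suc ℓ)                                   ≡⟨ parity-flip o (B (suc ℓ)) ⟩
    not ((not o xor B (suc ℓ)) xor o)           ≡⟨ cong (λ b → not ((b xor B (suc ℓ)) xor o)) inv ⟨
    not ((B (inject₁ c₀) xor B (suc ℓ)) xor o)  ≡⟨ cong (λ b → not (b xor o)) X≡xor ⟨
    not (crossesFrom c₀ xor o)                  ≡⟨ cong not (isOdd-suc-if (crossesFrom c₀) k) ⟨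
    not (isOdd (suc-if (crossesFrom c₀) k))     ≡⟨ cong (not ∘ isOdd) (crossingsBefore-step c₀ ℓ c₀≤ℓ quiet) ⟨
    not (isOdd (crossingsBeforeA (suc ℓ)))      ∎
    where
    open ≡-Reasoning
    k : ℕ
    k = crossingsBeforeA (inject₁ c₀)
    o : Bool
    o = isOdd k

  parity : ∀ g → ¬ T (E g) → B g ≡ not (isOdd (crossingsBeforeA g))
  parity g = go g (<-wellFounded g)
    where
    go : ∀ g → Acc Fin._<_ g → ¬ T (E g) → B g ≡ not (isOdd (crossingsBeforeA g))
    go zero _ _ = trans (T⇒≡true B₀) (cong (not ∘ isOdd) (sym (count-false {m})))
    go (suc ℓ) (acc rec) ¬e with T? (vp ℓ ∧ vq ℓ)
    ... | yes both = invariant-step (start ℓ) ℓ (start≤ℓ ℓ)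
      (λ d s<d d≤ℓ → ¬meets⇒¬crossesFrom (shared⇒¬meets (shared-inside ℓ d s<d d≤ℓ)))
      (crossing-at-start ℓ both ¬e) (go (inject₁ (start ℓ)) (rec (≤̄⇒inject₁< (start≤ℓ ℓ))) (apart ℓ))
    ... | no ¬both = invariant-step ℓ ℓ ℕ.≤-refl (λ d ℓ<d d≤ℓ → ⊥-elim (ℕ.<⇒≱ ℓ<d d≤ℓ)) X≡xor
      (go (inject₁ ℓ) (rec (≤̄⇒inject₁< ℕ.≤-refl)) (¬e ∘ subst T (sym (proj₁ (unchanged ℓ ¬both)))))
      where
      X≡xor : crossesFrom ℓ ≡ B (inject₁ ℓ) xor B (suc ℓ)
      X≡xor = trans (¬T⇒≡false (¬meets⇒¬crossesFrom (¬both ∘ meets⇒both)))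
        (trans (sym (xor-self (B (inject₁ ℓ)))) (cong (B (inject₁ ℓ) xor_) (sym (proj₂ (unchanged ℓ ¬both)))))

-- Defects and the map ψ

module _ (F : StarNet n m) {p q : WirePath n m} (isp : IsPath F p) (isq : IsPath F q)
         (p₀<q₀ : toℕ (p zero) < toℕ (q zero)) where

  private
    apart-at-sources : ¬ T (shareEdge F p q zero)
    apart-at-sources e = ℕ.<-irrefl (cong toℕ (sameEdge-source F e)) p₀<q₀

    below-at-sources : T (runsBelow F p q zero)
    below-at-sources = Below⇒belowAt F zero (p zero) (q zero) (p zero , sameEdge-refl F zero (p zero) ,
      λ u u~q₀ → subst (λ w → toℕ (p zero) < toℕ w) (sym (sameEdge-source F u~q₀)) p₀<q₀)

    open CrossingParity (visits F p) (visits F q) (shareEdge F p q) (runsBelow F p q) (runsBelow F q p)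
      (λ c → positions-across F c {p} {q} isp isq) (λ g → belowAt-flip F g) apart-at-sources below-at-sources

  odd-crossings⇒reversed : ∀ k → T (meets F p q k) → T (isOdd (crossingsBefore F p q k)) → ¬ T (precAt F k p q)
  odd-crossings⇒reversed k mk odd below = subst T (begin
    precAt F k p q                              ≡⟨ parity (inject₁ k) apart-at-k ⟩
    not (isOdd (crossingsBeforeA (inject₁ k)))  ≡⟨ cong (not ∘ isOdd) same-count ⟩
    not (isOdd (crossingsBefore F p q k))       ≡⟨ cong not (T⇒≡true odd) ⟩
    false                                       ∎) below
    where
    open ≡-Reasoning
    apart-at-k : ¬ T (shareEdge F p q (inject₁ k))
    apart-at-k = not-elim (∧-elimʳ {visits F q k} (∧-elimʳ {visits F p k} mk))
    same-count : crossingsBeforeA (inject₁ k) ≡ crossingsBefore F p q k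
    same-count = count-cong λ c → cong (λ x → (toℕ c <ᵇ x) ∧ crossesFrom c) (toℕ-inject₁ k)

defect⇒reversed : (F : StarNet n m) (π : Fin n → WirePath n m) → (∀ i → IsPath F (π i)) → (∀ i → π i zero ≡ i) →
  ∀ {k} a b → T (defect F π a b k) → ¬ T (precsimAt F k (π a) (π b))
defect⇒reversed F π isP starts {k} a b d ≾ with ∨-elim {precAt F k (π a) (π b)} ≾
... | inj₁ below = odd-crossings⇒reversed F {π a} {π b} (isP a) (isP b) a₀<b₀ k mk odd below
  where
  a₀<b₀ : toℕ (π a zero) < toℕ (π b zero)
  a₀<b₀ rewrite starts a | starts b = <F⇒< {i = a} {j = b} (∧-elimˡ d)
  mk : T (meets F (π a) (π b) k)
  mk = ∧-elimˡ (∧-elimʳ {a <F b} d)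
  odd : T (isOdd (crossingsBefore F (π a) (π b) k))
  odd = ∧-elimʳ {meets F (π a) (π b) k} (∧-elimʳ {a <F b} d)
... | inj₂ sim = not-elim (∧-elimʳ {visits F (π b) k} (∧-elimʳ {visits F (π a) k} (∧-elimˡ (∧-elimʳ {a <F b} d)))) sim

module _ (F : StarNet n m) (π : Fin n → WirePath n m) (s t : Fin n) (k : Fin m) where

  𝒞₁⇒ : ∀ i j → T (inC1 F π s t k i j) → T (precsimAt F k (π t) (π j)) × i ≡ s
  𝒞₁⇒ i j h = ∧-elimˡ h′ , ≡F⇒≡ (∧-elimˡ (∧-elimʳ {precAt F k (π j) (π i)} (∧-elimʳ {precsimAt F k (π t) (π j)} h′)))
    where
    h′ : T (precsimAt F k (π t) (π j) ∧ precAt F k (π j) (π i) ∧ (i ≡F s) ∧ not (j ≡F t))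
    h′ = ∧-elimʳ {inD F π s t k i j} h

  𝒞₂⇒ : ∀ i j → T (inC2 F π s t k i j) → T (precsimAt F k (π i) (π s)) × j ≡ t
  𝒞₂⇒ i j h = ∧-elimˡ (∧-elimʳ {precAt F k (π t) (π i)} (∧-elimʳ {j ≡F t} h′)) , ≡F⇒≡ (∧-elimˡ h′)
    where
    h′ : T ((j ≡F t) ∧ precAt F k (π t) (π i) ∧ precsimAt F k (π i) (π s) ∧ not (i ≡F s))
    h′ = ∧-elimʳ {inD F π s t k i j} h

  data ψ-View (i j : Fin n) : Fin n × Fin n → Set where
    fixed  : ψ-View i j (i , j)
    via-𝒞₁ : T (precsimAt F k (π t) (π j)) → i ≡ s → ψ-View i j (t , j)
    via-𝒞₂ : T (precsimAt F k (π i) (π s)) → j ≡ t → ψ-View i j (i , s)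

  ψ-view : ∀ i j → ψ-View i j (ψ F π s t k i j)
  ψ-view i j with inA F π s t k i j ∨ inB F π s t k i j | inC1 F π s t k i j in c₁ | inC2 F π s t k i j in c₂
  ... | true  | _     | _     = fixed
  ... | false | true  | _     = let t≾j , i≡s = 𝒞₁⇒ i j (subst T (sym c₁) _) in via-𝒞₁ t≾j i≡s
  ... | false | false | true  = let i≾s , j≡t = 𝒞₂⇒ i j (subst T (sym c₂) _) in via-𝒞₂ i≾s j≡t
  ... | false | false | false = fixed

  defect-irrefl : ∀ a → ¬ T (defect F π a a k)
  defect-irrefl a d = ℕ.<-irrefl refl (<F⇒< {i = a} {j = a} (∧-elimˡ d))

  module _ (¬≾ : ∀ a b → T (defect F π a b k) → ¬ T (precsimAt F k (π a) (π b))) where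

    ψ-injective : ∀ {i j i′ j′ x x′} → T (defect F π i j k) → T (defect F π i′ j′ k) →
      ψ-View i j x → ψ-View i′ j′ x′ → x ≡ x′ → (i , j) ≡ (i′ , j′)
    ψ-injective _ _ fixed fixed eq = eq
    ψ-injective {j′ = j′} d _ fixed (via-𝒞₁ t≾j′ _) refl = ⊥-elim (¬≾ t j′ d t≾j′)
    ψ-injective {i′ = i′} d _ fixed (via-𝒞₂ i′≾s _) refl = ⊥-elim (¬≾ i′ s d i′≾s)
    ψ-injective {j = j} _ d′ (via-𝒞₁ t≾j _) fixed refl = ⊥-elim (¬≾ t j d′ t≾j)
    ψ-injective {i = i} _ d′ (via-𝒞₂ i≾s _) fixed refl = ⊥-elim (¬≾ i s d′ i≾s)
    ψ-injective _ _ (via-𝒞₁ _ i≡s) (via-𝒞₁ _ i′≡s) refl = cong (_, _) (trans i≡s (sym i′≡s))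
    ψ-injective _ _ (via-𝒞₂ _ j≡t) (via-𝒞₂ _ j′≡t) refl = cong (_ ,_) (trans j≡t (sym j′≡t))
    ψ-injective d _ (via-𝒞₁ _ refl) (via-𝒞₂ _ _) refl = ⊥-elim (defect-irrefl s d)
    ψ-injective _ d′ (via-𝒞₂ _ _) (via-𝒞₁ _ refl) refl = ⊥-elim (defect-irrefl s d′)

lemma4p5 : ∀ {n m : ℕ} (F : StarNet n m) (π : Fin n → WirePath n m) → InΠ F π →
    (k : Fin m) → 1 ≤ toℕ k →
    (r t : Fin n) → LexLeastDefect F π k r t →
    (s : Fin n) → IsS F π k r t s →
    (c₀ ℓ : Fin m) → RightmostCrossing F (π s) (π t) k c₀ ℓ →
    (i j i' j' : Fin n) →
    T (inD F π s t k i j) → T (inD F π s t k i' j') →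
    ψ F π s t k i j ≡ ψ F π s t k i' j' → (i , j) ≡ (i' , j')
lemma4p5 F π (isPath , starts , _) k _ _ t _ s _ _ _ _ i j i' j' ij∈𝒟 i'j'∈𝒟 =
  ψ-injective F π s t k (defect⇒reversed F π isPath starts)
    (∧-elimˡ ij∈𝒟) (∧-elimˡ i'j'∈𝒟) (ψ-view F π s t k i j) (ψ-view F π s t k i' j')
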